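{- Let $A$ be an AL-monoid. If metric betweenness in $A$ has transitivity $t_1$, i.e. for all $a,b,c,d\in A$, $(a,b,c)M$ and $(a,d,b)M$ imply $(d,b,c)M$, then $A$ contains no isosceles triangle for which the sum of any two sides equals their join; that is, there are no pairwise distinct $a,b,c\in A$ such that two of the sides $a\ast b$, $b\ast c$, $c\ast a$ are equal and $s+t=s\vee t$ for any two distinct sides $s,t$ among them.
   Context: An AL-monoid (autometrized lattice ordered monoid) is an algebra $(A,+,\vee,\wedge,\ast,0)$ of type $(2,2,2,2,0)$ such that: (1) $(A,+,\vee,\wedge,0)$ is a commutative lattice ordered monoid, i.e. $(A,+,0)$ is a commutative monoid with identity $0$, $(A,\vee,\wedge)$ is a lattice with induced order $\leq$, and $a+(b\vee c)=(a+b)\vee(a+c)$, $a+(b\wedge c)=(a+b)\wedge(a+c)$; (2) $a\ast(a\wedge b)+b=a\vee b$ for all $a,b$; (3) for each $a\in A$ the maps $x\mapsto a+x$, $x\mapsto a\vee x$, $x\mapsto a\wedge x$, $x\mapsto a\ast x$ are contractions with respect to $\ast$, i.e. $f(x)\ast f(y)\leq x\ast y$ for all $x,y$; (4) $[a\ast(a\vee b)]\wedge[b\ast(a\vee b)]=0$ for all $a,b$; and $\ast$ is a metric operation: $a\ast b\geq 0$ with equality iff $a=b$, $a\ast b=b\ast a$, and $a\ast b\leq a\ast c+c\ast b$ for all $a,b,c$. Metric betweenness: $(a,x,b)M$ means $a\ast x+x\ast b=a\ast b$. A triangle is a triple of pairwise distinct elements $a,b,c$ with sides $a\ast b,b\ast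 c,c\ast a$; it is isosceles if two of its sides are equal. -}

module Defs where

open import Level using (Level; suc; _⊔_)
open import Relation.Binary.PropositionalEquality using (_≡_)
open import Relation.Nullary using (¬_)
open import Data.Product using (_×_; ∃-syntax)
open import Data.Sum using (_⊎_)


-- An AL-monoid (autometrized lattice ordered monoid), with propositional
-- equality on the carrier.  The lattice order is  a ≤ b  iff  a ∨ b ≡ b.
record ALMonoid (ℓ : Level) : Set (suc ℓ) where
  infixr 6 _∨_
  infixr 7 _∧_
  infixl 5 _+_
  infix 8 _✶_
  infix 4 _≤_
  field
    A   : Set ℓ
    _+_ : A → A → A
    _∨_ : A → A → A
    _∧_ : A → A → A
    _✶_ : A → A → A
    0#  : A

  _≤_ : A → A → Set ℓ
  a ≤ b = a ∨ b ≡ b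

  field
    +-assoc     : ∀ a b c → (a + b) + c ≡ a + (b + c)
    +-comm      : ∀ a b → a + b ≡ b + a
    +-identityˡ : ∀ a → 0# + a ≡ a
    ∨-assoc     : ∀ a b c → (a ∨ b) ∨ c ≡ a ∨ (b ∨ c)
    ∨-comm      : ∀ a b → a ∨ b ≡ b ∨ a
    ∧-assoc     : ∀ a b c → (a ∧ b) ∧ c ≡ a ∧ (b ∧ c)
    ∧-comm      : ∀ a b → a ∧ b ≡ b ∧ a
    ∨-absorbs-∧ : ∀ a b → a ∨ (a ∧ b) ≡ a
    ∧-absorbs-∨ : ∀ a b → a ∧ (a ∨ b) ≡ a
    +-distrib-∨ : ∀ a b c → a + (b ∨ c) ≡ (a + b) ∨ (a + c)
    +-distrib-∧ : ∀ a b c → a + (b ∧ c) ≡ (a + b) ∧ (a + c)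
    ✶-nonneg    : ∀ a b → 0# ≤ a ✶ b
    ✶-zero⇒≡    : ∀ a b → a ✶ b ≡ 0# → a ≡ b
    ✶-self      : ∀ a → a ✶ a ≡ 0#
    ✶-comm      : ∀ a b → a ✶ b ≡ b ✶ a
    ✶-triangle  : ∀ a b c → a ✶ b ≤ (a ✶ c) + (c ✶ b)
    ax2         : ∀ a b → (a ✶ (a ∧ b)) + b ≡ a ∨ b
    contr-+     : ∀ a x y → (a + x) ✶ (a + y) ≤ x ✶ y
    contr-∨     : ∀ a x y → (a ∨ x) ✶ (a ∨ y) ≤ x ✶ y
    contr-∧     : ∀ a x y → (a ∧ x) ✶ (a ∧ y) ≤ x ✶ y
    contr-✶     : ∀ a x y → (a ✶ x) ✶ (a ✶ y) ≤ x ✶ y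
    ax4         : ∀ a b → (a ✶ (a ∨ b)) ∧ (b ✶ (a ∨ b)) ≡ 0#

  Betw : A → A → A → Set ℓ
  Betw a x b = (a ✶ x) + (x ✶ b) ≡ a ✶ b

  Transitivity-t₁ : Set ℓ
  Transitivity-t₁ = ∀ a b c d → Betw a b c → Betw a d b → Betw d b c

  Triangle : A → A → A → Set ℓ
  Triangle a b c = ¬ a ≡ b × ¬ b ≡ c × ¬ c ≡ a

  Isosceles : A → A → A → Set ℓ
  Isosceles a b c = Triangle a b c ×
    (a ✶ b ≡ b ✶ c ⊎ b ✶ c ≡ c ✶ a ⊎ c ✶ a ≡ a ✶ b)

  -- for any two (distinct positions of) sides s, t: s + t ≡ s ∨ t
  SumIsJoin : A → A → A → Set ℓ
  SumIsJoin a b c =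
    ((a ✶ b) + (b ✶ c) ≡ (a ✶ b) ∨ (b ✶ c)) ×
    ((b ✶ c) + (c ✶ a) ≡ (b ✶ c) ∨ (c ✶ a)) ×
    ((c ✶ a) + (a ✶ b) ≡ (c ✶ a) ∨ (a ✶ b))

-- If two sides x = y of a triangle satisfy x + y = x ∨ y, then x + x = x, so the
-- triangle inequality bounds the third side z by x; the second sum-is-join
-- condition then gives y + z = x.  Hence each of the two vertices opposite the
-- equal sides lies metrically between the apex and the other one, and t₁ turns
-- this into z + z = 0, forcing z = 0: the triangle degenerates.
module Submission where

open import Defs
open import Level using (Level)
open import Relation.Nullary using (¬_)
open import Data.Product using (_×_; ∃-syntax; _,_)
open import Data.Sum using (inj₁; inj₂)
open import Relation.Binary.PropositionalEquality

module _ {ℓ : Level} (M : ALMonoid ℓ) where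
  open ALMonoid M
  open ≡-Reasoning

  ∨-idem : ∀ x → x ∨ x ≡ x
  ∨-idem x = begin
    x ∨ x              ≡⟨ cong (x ∨_) (sym (∧-absorbs-∨ x x)) ⟩
    x ∨ (x ∧ (x ∨ x))  ≡⟨ ∨-absorbs-∧ x (x ∨ x) ⟩
    x                  ∎

  +-identityʳ : ∀ a → a + 0# ≡ a
  +-identityʳ a = trans (+-comm a 0#) (+-identityˡ a)

  0≤x⇒x+x≡0⇒x≡0 : ∀ x → 0# ≤ x → x + x ≡ 0# → x ≡ 0#
  0≤x⇒x+x≡0⇒x≡0 x 0≤x x+x≡0 = begin
    x       ≡⟨ sym 0≤x ⟩
    0# ∨ x  ≡⟨ ∨-comm 0# x ⟩
    x ∨ 0#  ≡⟨ cong₂ _∨_ (sym (+-identityʳ x)) (sym x+x≡0) ⟩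
    (x + 0#) ∨ (x + x)  ≡⟨ sym (+-distrib-∨ x 0# x) ⟩
    x + (0# ∨ x)        ≡⟨ cong (x +_) 0≤x ⟩
    x + x               ≡⟨ x+x≡0 ⟩
    0#                  ∎

  x≡y⇒x+y≡x∨y⇒x+x≡x : ∀ x y → x ≡ y → x + y ≡ x ∨ y → x + x ≡ x
  x≡y⇒x+y≡x∨y⇒x+x≡x x y x≡y x+y≡x∨y = begin
    x + x  ≡⟨ cong (x +_) x≡y ⟩
    x + y  ≡⟨ x+y≡x∨y ⟩
    x ∨ y  ≡⟨ cong (x ∨_) (sym x≡y) ⟩
    x ∨ x  ≡⟨ ∨-idem x ⟩
    x      ∎

  ✶-betw-both⇒≡ : Transitivity-t₁ → ∀ q p r → Betw q p r → Betw q r p → r ≡ p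
  ✶-betw-both⇒≡ t₁ q p r qpr qrp =
    ✶-zero⇒≡ r p (0≤x⇒x+x≡0⇒x≡0 (r ✶ p) (✶-nonneg r p) rp+rp≡0)
    where
    rp+rp≡0 : r ✶ p + r ✶ p ≡ 0#
    rp+rp≡0 = begin
      r ✶ p + r ✶ p  ≡⟨ cong (r ✶ p +_) (✶-comm r p) ⟩
      r ✶ p + p ✶ r  ≡⟨ t₁ q p r r qpr qrp ⟩
      r ✶ r          ≡⟨ ✶-self r ⟩
      0#             ∎

  isosceles-sumIsJoin⇒betw-both : ∀ p q r → p ✶ q ≡ q ✶ r →
    p ✶ q + q ✶ r ≡ p ✶ q ∨ q ✶ r → q ✶ r + r ✶ p ≡ q ✶ r ∨ r ✶ p →
    Betw q p r × Betw q r p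
  isosceles-sumIsJoin⇒betw-both p q r x≡y x+y≡x∨y y+z≡y∨z = qpr , qrp
    where
    x = p ✶ q
    y = q ✶ r
    z = r ✶ p
    z≤x : z ≤ x
    x+x≡x : x + x ≡ x
    x+x≡x = x≡y⇒x+y≡x∨y⇒x+x≡x x y x≡y x+y≡x∨y
    z≤x+x : z ≤ x + x
    z≤x+x = subst₂ (λ u v → z ∨ (u + v) ≡ u + v)
              (trans (✶-comm r q) (sym x≡y)) (✶-comm q p) (✶-triangle r p q)
    z≤x = subst (λ w → z ∨ w ≡ w) x+x≡x z≤x+x
    y+z≡x : y + z ≡ x
    y+z≡x = begin
      y + z  ≡⟨ y+z≡y∨z ⟩
      y ∨ z  ≡⟨ cong (_∨ z) (sym x≡y) ⟩
      x ∨ z  ≡⟨ ∨-comm x z ⟩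
      z ∨ x  ≡⟨ z≤x ⟩
      x      ∎
    qpr : Betw q p r
    qpr = begin
      q ✶ p + p ✶ r  ≡⟨ cong₂ _+_ (trans (✶-comm q p) x≡y) (✶-comm p r) ⟩
      y + z          ≡⟨ y+z≡x ⟩
      x              ≡⟨ x≡y ⟩
      y              ∎
    qrp : Betw q r p
    qrp = trans y+z≡x (✶-comm p q)

  isosceles-sumIsJoin⇒degenerate : Transitivity-t₁ → ∀ p q r → p ✶ q ≡ q ✶ r →
    p ✶ q + q ✶ r ≡ p ✶ q ∨ q ✶ r → q ✶ r + r ✶ p ≡ q ✶ r ∨ r ✶ p → r ≡ p
  isosceles-sumIsJoin⇒degenerate t₁ p q r x≡y s₁ s₂
    with isosceles-sumIsJoin⇒betw-both p q r x≡y s₁ s₂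
  ... | qpr , qrp = ✶-betw-both⇒≡ t₁ q p r qpr qrp

mainTheorem5 : ∀ {ℓ : Level} (M : ALMonoid ℓ) → ALMonoid.Transitivity-t₁ M →
    ¬ (∃[ a ] ∃[ b ] ∃[ c ] (ALMonoid.Isosceles M a b c × ALMonoid.SumIsJoin M a b c))
mainTheorem5 M t₁ (a , b , c , ((a≢b , b≢c , c≢a) , equal-sides) , s₁ , s₂ , s₃)
  with equal-sides
... | inj₁ ab≡bc        = c≢a (isosceles-sumIsJoin⇒degenerate M t₁ a b c ab≡bc s₁ s₂)
... | inj₂ (inj₁ bc≡ca) = a≢b (isosceles-sumIsJoin⇒degenerate M t₁ b c a bc≡ca s₂ s₃)
... | inj₂ (inj₂ ca≡ab) = b≢c (isosceles-sumIsJoin⇒degenerate M t₁ c a b ca≡ab s₃ s₁)
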